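{- For every $j\in\mathbb Z^{\geq 0}$ the following hold: (i) If $j\geq 1$, then $W_j=\{m(j),m(j)+1,\dots,\lfloor\varphi j\rfloor\}$. (ii) If $j\geq 1$, then $z_{j,i}=b(k_j+i-1)$ for all $i\in\{1,\dots,j-n(j)-1\}$, where $k_j$ is the least natural number with $b(k_j)>n(j)$. (iii) If $j\geq 1$ and $j\in T_1$, then $n(j)=m(j)-2$. (iv) If $j\geq 1$ and $j\in T_2$, then $n(j)=m(j)-1$. (v) If $j\geq 1$ and $j\in T_3$, then $n(j)=m(j)$. (vi) $S_j=\emptyset$ if $j=0$; $S_j=\{0,1,\dots,\lfloor\varphi j\rfloor\}$ if $j\in A$; and $S_j=\{0,1,\dots,\lfloor\varphi j\rfloor\}\setminus\{\lfloor(\varphi-1)j\rfloor\}$ if $j\in B$. (vii) $q_j=0$ if $j=0$; $q_j=\lfloor\varphi j\rfloor+1$ if $j\in A$; and $q_j=\lfloor(\varphi-1)j\rfloor$ if $j\in B$.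
   Context: Let $\varphi=\frac{1+\sqrt5}{2}$, $\mathbb N=\{1,2,\dots\}$, $a(n)=\lfloor n\varphi\rfloor$, $b(n)=\lfloor n\varphi^2\rfloor$, $A=\{a(n)\mid n\in\mathbb N\}$, $B=\{b(n)\mid n\in\mathbb N\}$. For $X\subseteq\mathbb Z^{\geq0}$, $\mathrm{mex}(X)=\min(\mathbb Z^{\geq0}\setminus X)$. Define nonnegative integers $q_{i,j}$ ($i,j\in\mathbb Z^{\geq0}$) recursively, in order of increasing $i$ and for fixed $i$ increasing $j$, by $q_{i,j}=\mathrm{mex}(S_{i,j}\cap\mathbb Z^{\geq0})$ with $S_{i,j}=\{q_{i,k}+q_{l,j}-q_{l,k}\mid 0\leq l<i,\ 0\leq k<j\}$ (so $q_{0,j}=0$, $q_{1,j}=j$). Put $q_j=q_{2,j}$ and $S_j=S_{2,j}$. For $j\in\mathbb Z^{\geq0}$ let $U_j=\{q_k\mid 0\leq k<j\}$ and $W_j=\{q_k+j-k\mid 0\leq k<j\}$. For $j\in\mathbb N$ let $n(j)=\max\{k\mid\{0,1,\dots,k\}\subseteq U_j\}$, write $U_j=\{0,1,\dots,n(j)\}\cup\{z_{j,1},\dots,z_{j,j-n(j)-1}\}$ with $n(j)+2\leq z_{j,1}<\dots<z_{j,j-n(j)-1}$, and let $m(j)=\lfloor\varphi j\rfloor-j+1$. Finally $T_1=\{b(n)\mid n\in\mathbb N\}$, $T_2=\{b(n)-1\mid n\in\mathbb N\}$, $T_3=\{2a(n)+n\mid n\in\mathbb N\}$. -}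

module Defs where

open import Data.Nat as ℕ using (ℕ; zero; suc; _+_; _*_; _∸_; _≤_; _<_; _≤?_; _⊔_)
open import Data.Integer as ℤ using (ℤ; +_; _-_)
import Data.Integer.Properties as ℤP
import Data.Nat.Properties as ℕP
open import Data.List using (List; []; _∷_; _∷ʳ_; length; filter; map; upTo; concatMap; zipWith; foldr)
open import Data.List.Relation.Unary.Any using (any?)
open import Data.List.Membership.Propositional using (_∈_)
open import Data.Maybe using (Maybe; just; nothing)
open import Data.Product using (Σ; ∃; ∃-syntax; _×_; _,_)
open import Relation.Binary.PropositionalEquality using (_≡_)
open import Relation.Nullary using (¬_; yes; no)

-- For m, n ∈ ℕ:  m ≤ n·φ  ⇔  m² ≤ m·n + n²   (roots of x² - n x - n² are nφ and -n/φ).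
-- The set {m ≥ 1 | m ≤ nφ} is {1,…,⌊nφ⌋} ⊆ {1,…,2n}, so counting gives ⌊nφ⌋.

floorφ : ℕ → ℕ
floorφ n = length (filter (λ m → m * m ≤? m * n + n * n) (map suc (upTo (2 * n))))

a : ℕ → ℕ
a n = floorφ n

-- b(n) = ⌊nφ²⌋ = ⌊n(φ+1)⌋ = ⌊nφ⌋ + n
b : ℕ → ℕ
b n = floorφ n + n

floorφ-1 : ℕ → ℕ
floorφ-1 j = floorφ j ∸ j

-- m(j) = ⌊φ j⌋ - j + 1   (⌊φ j⌋ ≥ j, so truncated subtraction is exact)
mfun : ℕ → ℕ
mfun j = (floorφ j ∸ j) + 1

InA : ℕ → Set
InA j = ∃[ n ] (1 ≤ n × a n ≡ j)

InB : ℕ → Set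
InB j = ∃[ n ] (1 ≤ n × b n ≡ j)

InT₁ : ℕ → Set
InT₁ j = ∃[ n ] (1 ≤ n × b n ≡ j)

InT₂ : ℕ → Set
InT₂ j = ∃[ n ] (1 ≤ n × b n ∸ 1 ≡ j)   -- b n ≥ 2 for n ≥ 1, so ∸ is exact

InT₃ : ℕ → Set
InT₃ j = ∃[ n ] (1 ≤ n × 2 * a n + n ≡ j)

-- mex of a finite list of integers: least n ∈ ℕ with (+ n) not in the list.
-- Fuel = length suffices: if 0,…,L-1 all occur in a list of length L, then L does not.

mexAux : ℕ → ℕ → List ℤ → ℕ
mexAux zero    n zs = n
mexAux (suc f) n zs with any? (λ z → (+ n) ℤ.≟ z) zs
... | yes _ = mexAux f (suc n) zs
... | no  _ = n

mex : List ℤ → ℕ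
mex zs = mexAux (length zs) 0 zs

-- A "row" is a function ℕ → ℕ (j ↦ q_{l,j}).
-- Sset prev xs j  lists S_{i,j} = { q_{i,k} + q_{l,j} - q_{l,k} | l < i, k < j }
-- where prev = [row 0, …, row (i-1)] and xs = [q_{i,0}, …, q_{i,j-1}].
Sset : List (ℕ → ℕ) → List ℕ → ℕ → List ℤ
Sset prev xs j =
  concatMap (λ r → zipWith (λ k xk → ((+ xk) ℤ.+ (+ r j)) - (+ r k)) (upTo j) xs) prev

mutual
  -- rowAt prev j = q_{i,j}, rowVals prev j = [q_{i,0}, …, q_{i,j-1}]
  rowAt : List (ℕ → ℕ) → ℕ → ℕ
  rowAt prev j = mex (Sset prev (rowVals prev j) j)

  rowVals : List (ℕ → ℕ) → ℕ → List ℕ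
  rowVals prev zero    = []
  rowVals prev (suc j) = rowVals prev j ∷ʳ rowAt prev j

rows : ℕ → List (ℕ → ℕ)
rows zero    = []
rows (suc i) = rows i ∷ʳ rowAt (rows i)

qq : ℕ → ℕ → ℕ
qq i j = rowAt (rows i) j

SS : ℕ → ℕ → List ℤ
SS i j = Sset (rows i) (rowVals (rows i) j) j

q : ℕ → ℕ
q j = qq 2 j

S : ℕ → List ℤ
S j = SS 2 j

InU : ℕ → ℕ → Set
InU j x = ∃[ k ] (k < j × q k ≡ x)

InW : ℕ → ℤ → Set
InW j z = ∃[ k ] (k < j × z ≡ ((+ q k) ℤ.+ (+ j)) - (+ k))

-- IsN j n  :⇔  n = n(j) = max{k | {0,…,k} ⊆ U_j}
IsN : ℕ → ℕ → Set
IsN j n = (∀ k → k ≤ n → InU j k) × ¬ InU j (suc n)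

-- U_j as a list [q_0,…,q_{j-1}], and its elements in strictly increasing order
Ulist : ℕ → List ℕ
Ulist j = rowVals (rows 2) j

Uasc : ℕ → List ℕ
Uasc j = filter (λ x → any? (λ y → x ℕ.≟ y) (Ulist j)) (upTo (suc (foldr _⊔_ 0 (Ulist j))))

-- 0-indexed list lookup
nth : ℕ → List ℕ → Maybe ℕ
nth _       []       = nothing
nth zero    (x ∷ xs) = just x
nth (suc i) (x ∷ xs) = nth i xs

IsLeastK : ℕ → ℕ → Set
IsLeastK n k = 1 ≤ k × n < b k × (∀ k′ → 1 ≤ k′ → k′ < k → b k′ ≤ n)

-- Row 1 of the table is the identity, so S_j = U_j ∪ W_j. Everything rests on one fact, proved by
-- strong induction on j: q fixes 0 and swaps a p with b p. Assuming this below j, the Beatty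
-- inequalities a m < j ⇔ m + j ≤ a j and b m < j ⇔ m + a j < 2j turn W_j = {j} ∪ {j + p | a p < j}
-- ∪ {j − p | b p < j} into the interval [m(j), a j], while U_j = {y | partner of y < j}; the mex of
-- S_j is then b p when j = a p and a p when j = b p. Once q is known, U_j consists of 0, …, a B − 1
-- and the b m with a m < j, where B = 2j − a j is the least index with b B ≥ j, so n(j) = a B − 1 and
-- (ii)–(v) follow by computing B. The floor ⌊nφ⌋ is only ever used through m ≤ nφ ⇔ m² ≤ mn + n²,
-- with irrationality of φ excluding equality.

module Submission where

open import Defs
open import Data.Nat using (ℕ; zero; suc; _+_; _∸_; _≤_; _<_; _*_; _⊔_; z≤n; s≤s; _≟_; _≤?_; _<?_; >-nonZero)
open import Data.Nat.Induction using (<-rec)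
open import Data.Nat.Properties
open import Data.Nat.Tactic.RingSolver using (solve-∀)
open import Data.Integer as ℤ using (ℤ; +_)
import Data.Integer.Properties as ℤ
open import Data.List using (List; []; _∷_; _∷ʳ_; _++_; length; filter; map; upTo; applyUpTo; zipWith; concatMap; lookup; foldr)
import Data.List.Properties as List
open import Data.List.Membership.Propositional using (_∈_)
open import Data.List.Relation.Unary.Any using (here; there; any?; index)
import Data.List.Relation.Unary.Any.Properties as Any
open import Data.Fin using (Fin; toℕ)
import Data.Fin.Properties as Fin
open import Data.Maybe using (just)
open import Data.Product using (_×_; _,_; proj₁; proj₂; ∃-syntax)
open import Data.Sum using (_⊎_; inj₁; inj₂; [_,_]′)
open import Data.Empty using (⊥-elim)
open import Function using (_∘_; id)
open import Function.Bundles using (_⇔_; mk⇔; Equivalence)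
open import Level using (0ℓ)
open import Relation.Binary.Definitions using (Tri; tri<; tri≈; tri>)
open import Relation.Binary.PropositionalEquality
open import Relation.Nullary using (¬_; yes; no; Dec; contradiction)
open import Relation.Unary using (Pred; Decidable)

module DownwardClosedCount {P : Pred ℕ 0ℓ} (P? : Decidable P) (P-pred : ∀ {m} → P (suc m) → P m) where

  count : ℕ → ℕ
  count K = length (filter P? (map suc (upTo K)))

  count-suc : ∀ K → count (suc K) ≡ count K + length (filter P? (suc K ∷ []))
  count-suc K = begin
    length (filter P? (map suc (upTo (suc K))))
      ≡⟨ cong (λ l → length (filter P? (map suc l))) (sym (List.upTo-∷ʳ K)) ⟩
    length (filter P? (map suc (upTo K ++ K ∷ [])))
      ≡⟨ cong (λ l → length (filter P? l)) (List.map-++ suc (upTo K) (K ∷ [])) ⟩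
    length (filter P? (map suc (upTo K) ++ suc K ∷ []))
      ≡⟨ cong length (List.filter-++ P? (map suc (upTo K)) (suc K ∷ [])) ⟩
    length (filter P? (map suc (upTo K)) ++ filter P? (suc K ∷ []))
      ≡⟨ List.length-++ (filter P? (map suc (upTo K))) ⟩
    count K + length (filter P? (suc K ∷ [])) ∎
    where open ≡-Reasoning

  count-accept : ∀ K → P (suc K) → count (suc K) ≡ suc (count K)
  count-accept K p = trans (count-suc K)
    (trans (cong (λ l → count K + length l) (List.filter-accept P? p)) (+-comm (count K) 1))

  count-reject : ∀ K → ¬ P (suc K) → count (suc K) ≡ count K
  count-reject K ¬p = trans (count-suc K)
    (trans (cong (λ l → count K + length l) (List.filter-reject P? ¬p)) (+-identityʳ (count K)))

  P-≤ : ∀ {m n} → m ≤ n → P n → P m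
  P-≤ {n = zero} z≤n p = p
  P-≤ {n = suc n} m≤1+n p with m≤n⇒m<n∨m≡n m≤1+n
  ... | inj₁ m<1+n = P-≤ (m<1+n⇒m≤n m<1+n) (P-pred p)
  ... | inj₂ refl = p

  count-full : ∀ K → P K → count K ≡ K
  count-full zero _ = refl
  count-full (suc K) p = trans (count-accept K p) (cong suc (count-full K (P-pred p)))

  ≤count⇒P : ∀ {m} K → 1 ≤ m → m ≤ count K → P m
  ≤count⇒P zero 1≤m m≤0 = contradiction (≤-trans 1≤m m≤0) λ ()
  ≤count⇒P {m} (suc K) 1≤m m≤c with P? (suc K)
  ... | yes p = P-≤ (subst (m ≤_) (count-full (suc K) p) m≤c) p
  ... | no ¬p = ≤count⇒P K 1≤m (subst (m ≤_) (count-reject K ¬p) m≤c)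

  P⇒≤count : ∀ {m} K → m ≤ K → P m → m ≤ count K
  P⇒≤count zero z≤n _ = z≤n
  P⇒≤count {m} (suc K) m≤1+K pm with P? (suc K)
  ... | yes p = subst (m ≤_) (sym (count-full (suc K) p)) m≤1+K
  ... | no ¬p = subst (m ≤_) (sym (count-reject K ¬p))
    (P⇒≤count K (m<1+n⇒m≤n (≤∧≢⇒< m≤1+K λ { refl → ¬p pm })) pm)

infix 4 _≤φ_

_≤φ_ : ℕ → ℕ → Set
m ≤φ n = m * m ≤ m * n + n * n

≤φ-pred : ∀ m n → suc m ≤φ n → m ≤φ n
≤φ-pred m n h with m ≤? n
... | yes m≤n = ≤-trans (*-monoʳ-≤ m m≤n) (m≤m+n (m * n) (n * n))
... | no m≰n = +-cancelʳ-≤ (1 + (m + m)) (m * m) (m * n + n * n) (begin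
    m * m + (1 + (m + m))             ≡⟨ square-suc m ⟩
    suc m * suc m                     ≤⟨ h ⟩
    suc m * n + n * n                 ≡⟨ expand m n ⟩
    (m * n + n * n) + n               ≤⟨ +-monoʳ-≤ (m * n + n * n) n≤1+2m ⟩
    (m * n + n * n) + (1 + (m + m))   ∎)
  where
  open ≤-Reasoning
  square-suc : ∀ m → m * m + (1 + (m + m)) ≡ suc m * suc m
  square-suc = solve-∀
  expand : ∀ m n → suc m * n + n * n ≡ (m * n + n * n) + n
  expand = solve-∀
  n≤1+2m : n ≤ 1 + (m + m)
  n≤1+2m = ≤-trans (<⇒≤ (≰⇒> m≰n)) (≤-trans (m≤m+n m m) (n≤1+n _))

≤φ⇒≤2* : ∀ m n → m ≤φ n → m ≤ 2 * n
≤φ⇒≤2* m n h with m ≤? 2 * n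
... | yes m≤2n = m≤2n
... | no m≰2n = contradiction h (<⇒≱ (begin-strict
    m * n + n * n       ≤⟨ +-monoʳ-≤ (m * n) (*-monoˡ-≤ n n≤m) ⟩
    m * n + m * n       <⟨ m<m+n (m * n + m * n) (≤-trans (s≤s z≤n) 1+2n≤m) ⟩
    m * n + m * n + m   ≡⟨ expand m n ⟩
    m * suc (2 * n)     ≤⟨ *-monoʳ-≤ m 1+2n≤m ⟩
    m * m               ∎))
  where
  open ≤-Reasoning
  expand : ∀ m n → m * n + m * n + m ≡ m * suc (2 * n)
  expand = solve-∀
  1+2n≤m : suc (2 * n) ≤ m
  1+2n≤m = ≰⇒> m≰2n
  n≤m : n ≤ m
  n≤m = ≤-trans (≤-trans (m≤m+n n (n + 0)) (n≤1+n _)) 1+2n≤m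

≤φ⇒≤a : ∀ {m} n → m ≤φ n → m ≤ a n
≤φ⇒≤a {zero} n _ = z≤n
≤φ⇒≤a {suc m} n h = P⇒≤count (2 * n) (≤φ⇒≤2* (suc m) n h) h
  where open DownwardClosedCount (λ m → m * m ≤? m * n + n * n) (λ {m} → ≤φ-pred m n)

≤a⇒≤φ : ∀ {m} n → m ≤ a n → m ≤φ n
≤a⇒≤φ {zero} n _ = z≤n
≤a⇒≤φ {suc m} n m≤an = ≤count⇒P (2 * n) (s≤s z≤n) m≤an
  where open DownwardClosedCount (λ m → m * m ≤? m * n + n * n) (λ {m} → ≤φ-pred m n)

a<⇒≰φ : ∀ {m} n → a n < m → ¬ m ≤φ n
a<⇒≰φ n an<m h = <⇒≱ an<m (≤φ⇒≤a n h)

≰φ⇒a< : ∀ {m} n → ¬ m ≤φ n → a n < m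
≰φ⇒a< n m≰φn = ≰⇒> λ m≤an → m≰φn (≤a⇒≤φ n m≤an)

a-self : ∀ n → a n ≤φ n
a-self n = ≤a⇒≤φ n ≤-refl

n≤a : ∀ n → n ≤ a n
n≤a n = ≤φ⇒≤a n (m≤m+n (n * n) (n * n))

a<2* : ∀ {n} → 1 ≤ n → a n < 2 * n
a<2* {n} 1≤n = ≰φ⇒a< n λ h → <⇒≱ (begin-strict
    2 * n * n + n * n       <⟨ m<n+m (2 * n * n + n * n) (*-mono-≤ 1≤n 1≤n) ⟩
    n * n + (2 * n * n + n * n) ≡⟨ expand n ⟩
    2 * n * (2 * n)         ∎) h
  where
  open ≤-Reasoning
  expand : ∀ n → n * n + (2 * n * n + n * n) ≡ 2 * n * (2 * n)
  expand = solve-∀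

≤φ-suc-suc : ∀ x y → x ≤φ y → suc x ≤φ suc y
≤φ-suc-suc x y h = begin
    suc x * suc x                               ≡⟨ expandˡ x ⟩
    x * x + (x + suc x)                         ≤⟨ +-mono-≤ h (+-mono-≤ (m≤m+n x y) 1+x≤2+2y) ⟩
    (x * y + y * y) + ((x + y) + (2 * y + 2))   ≡⟨ expandʳ x y ⟩
    suc x * suc y + suc y * suc y               ∎
  where
  open ≤-Reasoning
  expandˡ : ∀ x → suc x * suc x ≡ x * x + (x + suc x)
  expandˡ = solve-∀
  expandʳ : ∀ x y → (x * y + y * y) + ((x + y) + (2 * y + 2)) ≡ suc x * suc y + suc y * suc y
  expandʳ = solve-∀
  1+x≤2+2y : suc x ≤ 2 * y + 2
  1+x≤2+2y = ≤-trans (s≤s (≤φ⇒≤2* x y h)) (≤-trans (≤-reflexive (+-comm 1 (2 * y))) (+-monoʳ-≤ (2 * y) (s≤s z≤n)))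

≤φ-sucʳ : ∀ x y → x ≤φ y → x ≤φ suc y
≤φ-sucʳ x y h = ≤-trans h (+-mono-≤ (*-monoʳ-≤ x (n≤1+n y)) (*-mono-≤ (n≤1+n y) (n≤1+n y)))

a-suc : ∀ n → a n < a (suc n)
a-suc n = ≤φ⇒≤a (suc n) (≤φ-suc-suc (a n) n (a-self n))

module StrictlyIncreasing (g : ℕ → ℕ) (g-suc : ∀ n → g n < g (suc n)) where

  strict : ∀ {m n} → m < n → g m < g n
  strict {m} {suc n} m<1+n with m≤n⇒m<n∨m≡n (m<1+n⇒m≤n m<1+n)
  ... | inj₁ m<n = <-trans (strict m<n) (g-suc n)
  ... | inj₂ refl = g-suc n

  mono : ∀ {m n} → m ≤ n → g m ≤ g n
  mono m≤n with m≤n⇒m<n∨m≡n m≤n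
  ... | inj₁ m<n = <⇒≤ (strict m<n)
  ... | inj₂ refl = ≤-refl

  injective : ∀ {m n} → g m ≡ g n → m ≡ n
  injective {m} {n} e with <-cmp m n
  ... | tri< m<n _ _ = contradiction e (<⇒≢ (strict m<n))
  ... | tri≈ _ m≡n _ = m≡n
  ... | tri> _ _ n<m = contradiction (sym e) (<⇒≢ (strict n<m))

  cancel-< : ∀ {m n} → g m < g n → m < n
  cancel-< gm<gn = ≰⇒> λ n≤m → <⇒≱ gm<gn (mono n≤m)

open StrictlyIncreasing a a-suc using ()
  renaming (strict to a-strict; injective to a-injective; cancel-< to a-cancel-<)
open StrictlyIncreasing b (λ n → +-mono-< (a-suc n) (n<1+n n)) using ()
  renaming (strict to b-strict; mono to b-mono; injective to b-injective; cancel-< to b-cancel-<)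

-- Descent: m² = mn + n² forces n < m < 2n, and then n² = n(m − n) + (m − n)².
φ-irrational : ∀ n m → 1 ≤ n → m * m ≢ m * n + n * n
φ-irrational = <-rec _ descent
  where
  descent : ∀ n → (∀ {d} → d < n → ∀ m → 1 ≤ d → m * m ≢ m * d + d * d) →
            ∀ m → 1 ≤ n → m * m ≢ m * n + n * n
  descent n smaller m 1≤n e with n <? m
  ... | no n≮m = <-irrefl e (≤-<-trans (*-monoʳ-≤ m (≮⇒≥ n≮m)) (m<m+n (m * n) (*-mono-≤ 1≤n 1≤n)))
  ... | yes n<m with 2 * n ≤? m
  ...   | yes 2n≤m = <-irrefl (sym e) (begin-strict
      m * n + n * n   <⟨ +-monoʳ-< (m * n) (*-monoˡ-< n n<m) ⟩
      m * n + m * n   ≡⟨ double m n ⟩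
      m * (2 * n)     ≤⟨ *-monoʳ-≤ m 2n≤m ⟩
      m * m           ∎)
    where
    open ≤-Reasoning
    instance _ = >-nonZero 1≤n
    double : ∀ m n → m * n + m * n ≡ m * (2 * n)
    double = solve-∀
  ...   | no 2n≰m with m≤n⇒∃[o]m+o≡n (<⇒≤ n<m)
  ...     | d , refl = smaller d<n n 1≤d (+-cancelʳ-≡ (n * n + n * d) _ _ (begin
      n * n + (n * n + n * d)   ≡⟨ rearrangeˡ n d ⟩
      (n + d) * n + n * n       ≡⟨ sym e ⟩
      (n + d) * (n + d)         ≡⟨ rearrangeʳ n d ⟩
      (n * d + d * d) + (n * n + n * d) ∎))
    where
    open ≡-Reasoning
    rearrangeˡ : ∀ n d → n * n + (n * n + n * d) ≡ (n + d) * n + n * n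
    rearrangeˡ = solve-∀
    rearrangeʳ : ∀ n d → (n + d) * (n + d) ≡ (n * d + d * d) + (n * n + n * d)
    rearrangeʳ = solve-∀
    1≤d : 1 ≤ d
    1≤d = +-cancelˡ-< n 0 d (subst (_< n + d) (sym (+-identityʳ n)) n<m)
    d<n : d < n
    d<n = +-cancelˡ-< n d n (≤-trans (≰⇒> 2n≰m) (≤-reflexive (cong (_+_ n) (+-identityʳ n))))

+-cancelʳ-≤-⇔ : ∀ c {x y u v} → u ≡ x + c → v ≡ y + c → (u ≤ v) ⇔ (x ≤ y)
+-cancelʳ-≤-⇔ c {x} {y} refl refl = mk⇔ (+-cancelʳ-≤ c x y) (+-monoˡ-≤ c)

-- With Q(x, y) = x² − xy − y², x ≤φ y says Q(x, y) ≤ 0, and Q(m + j, j) = −Q(j, m), Q(m + 2d, m + d) = Q(d, m).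
≤φ-offset : ∀ m j → (m + j ≤φ j) ⇔ (m * m + m * j ≤ j * j)
≤φ-offset m j = +-cancelʳ-≤-⇔ (m * j + j * j) (expandˡ m j) (expandʳ m j)
  where
  expandˡ : ∀ m j → (m + j) * (m + j) ≡ (m * m + m * j) + (m * j + j * j)
  expandˡ = solve-∀
  expandʳ : ∀ m j → (m + j) * j + j * j ≡ j * j + (m * j + j * j)
  expandʳ = solve-∀

≤φ-step : ∀ d m → (m + 2 * d ≤φ m + d) ⇔ (d ≤φ m)
≤φ-step d m = +-cancelʳ-≤-⇔ (m * m + 4 * (m * d) + 3 * (d * d)) (expandˡ m d) (expandʳ m d)
  where
  expandˡ : ∀ m d → (m + 2 * d) * (m + 2 * d) ≡ d * d + (m * m + 4 * (m * d) + 3 * (d * d))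
  expandˡ = solve-∀
  expandʳ : ∀ m d → (m + 2 * d) * (m + d) + (m + d) * (m + d) ≡ (d * m + m * m) + (m * m + 4 * (m * d) + 3 * (d * d))
  expandʳ = solve-∀

a<⇒+≤a : ∀ m j → a m < j → m + j ≤ a j
a<⇒+≤a m j am<j = ≤φ⇒≤a j (Equivalence.from (≤φ-offset m j) (begin
    m * m + m * j   ≡⟨ swap m j ⟩
    j * m + m * m   ≤⟨ <⇒≤ (≰⇒> (a<⇒≰φ m am<j)) ⟩
    j * j           ∎))
  where
  open ≤-Reasoning
  swap : ∀ m j → m * m + m * j ≡ j * m + m * m
  swap = solve-∀

+≤a⇒a< : ∀ m j → 1 ≤ m → m + j ≤ a j → a m < j
+≤a⇒a< m j 1≤m m+j≤aj = ≰φ⇒a< m λ j≤φm → φ-irrational m j 1≤m (≤-antisym j≤φm (begin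
    j * m + m * m   ≡⟨ swap m j ⟩
    m * m + m * j   ≤⟨ Equivalence.to (≤φ-offset m j) (≤a⇒≤φ j m+j≤aj) ⟩
    j * j           ∎))
  where
  open ≤-Reasoning
  swap : ∀ m j → j * m + m * m ≡ m * m + m * j
  swap = solve-∀

b<⇒+a<2* : ∀ m j → b m < j → m + a j < 2 * j
b<⇒+a<2* m j bm<j with m≤n⇒∃[o]m+o≡n (≤-trans (m≤n+m m (a m)) (<⇒≤ bm<j))
... | d , refl = subst (m + a (m + d) <_) (double m d) (+-monoʳ-< m a[m+d]<m+2d)
  where
  double : ∀ m d → m + (m + 2 * d) ≡ 2 * (m + d)
  double = solve-∀
  am<d : a m < d
  am<d = +-cancelʳ-< m (a m) d (subst (a m + m <_) (+-comm m d) bm<j)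
  a[m+d]<m+2d : a (m + d) < m + 2 * d
  a[m+d]<m+2d = ≰φ⇒a< (m + d) λ h → a<⇒≰φ m am<d (Equivalence.to (≤φ-step d m) h)

+a<2*⇒b< : ∀ m j → m + a j < 2 * j → b m < j
+a<2*⇒b< m j m+aj<2j with m≤n⇒∃[o]m+o≡n (<⇒≤ m<j)
  where
  m<j : m < j
  m<j = +-cancelʳ-< j m j (begin-strict
    m + j     ≤⟨ +-monoʳ-≤ m (n≤a j) ⟩
    m + a j   <⟨ m+aj<2j ⟩
    2 * j     ≡⟨ cong (_+_ j) (+-identityʳ j) ⟩
    j + j     ∎)
    where open ≤-Reasoning
... | d , refl = subst (b m <_) (+-comm d m) (+-monoˡ-< m am<d)
  where
  double : ∀ m d → 2 * (m + d) ≡ m + (m + 2 * d)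
  double = solve-∀
  a[m+d]<m+2d : a (m + d) < m + 2 * d
  a[m+d]<m+2d = +-cancelˡ-< m _ _ (subst (m + a (m + d) <_) (double m d) m+aj<2j)
  am<d : a m < d
  am<d = ≰φ⇒a< m λ h → a<⇒≰φ (m + d) a[m+d]<m+2d (Equivalence.from (≤φ-step d m) h)

a∘a+1≡b : ∀ {p} → 1 ≤ p → a (a p) + 1 ≡ b p
a∘a+1≡b {suc p} _ = begin
    a (a (suc p)) + 1     ≡⟨ cong (_+ 1) (≤-antisym (m<1+n⇒m≤n upper) lower) ⟩
    a (suc p) + p + 1     ≡⟨ +-assoc (a (suc p)) p 1 ⟩
    a (suc p) + (p + 1)   ≡⟨ cong (_+_ (a (suc p))) (+-comm p 1) ⟩
    a (suc p) + suc p     ∎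
  where
  open ≡-Reasoning
  upper : a (a (suc p)) < suc (a (suc p) + p)
  upper = ≰⇒> λ h → <-irrefl refl
    (+≤a⇒a< (suc p) (a (suc p)) (s≤s z≤n) (subst (_≤ a (a (suc p))) (cong suc (+-comm (a (suc p)) p)) h))
  lower : a (suc p) + p ≤ a (a (suc p))
  lower = subst (_≤ a (a (suc p))) (+-comm p (a (suc p))) (a<⇒+≤a p (a (suc p)) (a-suc p))

a∘b≡a+b : ∀ {p} → 1 ≤ p → a (b p) ≡ a p + b p
a∘b≡a+b {suc p} _ = ≤-antisym (≤-pred upper) lower
  where
  s = a (suc p)
  lower : s + (s + suc p) ≤ a (s + suc p)
  lower = subst₂ (λ x y → x ≤ a y) (rearrangeˡ s p) (+-comm (suc p) s)
    (≤φ⇒≤a (suc p + s) (Equivalence.from (≤φ-step s (suc p)) (a-self (suc p))))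
    where
    rearrangeˡ : ∀ s p → suc p + 2 * s ≡ s + (s + suc p)
    rearrangeˡ = solve-∀
  upper : a (s + suc p) < suc (s + (s + suc p))
  upper = ≰φ⇒a< (s + suc p) λ h → <-irrefl refl (≤φ⇒≤a (suc p)
    (≤φ-sucʳ (suc s) p (Equivalence.to (≤φ-step (suc s) p) (subst₂ _≤φ_ (rearrangeʳ₁ s p) (rearrangeʳ₂ s p) h))))
    where
    rearrangeʳ₁ : ∀ s p → suc (s + (s + suc p)) ≡ p + 2 * suc s
    rearrangeʳ₁ = solve-∀
    rearrangeʳ₂ : ∀ s p → s + suc p ≡ p + suc s
    rearrangeʳ₂ = solve-∀

-- A jump of 3 at n would force n ≤ a m < a (m + 1) ≤ n for m = a (n + 1) − n − 2.
a-suc≤ : ∀ n → a (suc n) ≤ 2 + a n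
a-suc≤ n with a (suc n) ≤? 2 + a n
... | yes ≤2+an = ≤2+an
... | no ≰2+an = ⊥-elim (<-irrefl refl (<-≤-trans (≤-<-trans n≤am (a-suc m)) (≤-pred a[1+m]<1+n)))
  where
  3+an≤a[1+n] : 3 + a n ≤ a (suc n)
  3+an≤a[1+n] = ≰⇒> ≰2+an
  m = a (suc n) ∸ (2 + n)
  m+2+n≡a[1+n] : m + (2 + n) ≡ a (suc n)
  m+2+n≡a[1+n] = m∸n+n≡m (≤-trans (s≤s (s≤s (n≤a n))) (≤-trans (n≤1+n _) 3+an≤a[1+n]))
  a[1+m]<1+n : a (suc m) < suc n
  a[1+m]<1+n = +≤a⇒a< (suc m) (suc n) (s≤s z≤n) (≤-reflexive (trans (sym (+-suc m (suc n))) m+2+n≡a[1+n]))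
  n≤am : n ≤ a m
  n≤am = ≮⇒≥ λ am<n → <-irrefl refl (begin-strict
    a (suc n)         ≡⟨ sym m+2+n≡a[1+n] ⟩
    m + (2 + n)       ≡⟨ +-suc m (suc n) ⟩
    suc (m + suc n)   ≡⟨ cong suc (+-suc m n) ⟩
    2 + (m + n)       ≤⟨ +-monoʳ-≤ 2 (a<⇒+≤a m n am<n) ⟩
    2 + a n           <⟨ 3+an≤a[1+n] ⟩
    a (suc n)         ∎)
    where open ≤-Reasoning

a∘suc∘a≡suc∘b : ∀ {p} → 1 ≤ p → a (suc (a p)) ≡ suc (b p)
a∘suc∘a≡suc∘b {p} 1≤p = ≤-antisym
  (≤-trans (a-suc≤ (a p)) (≤-reflexive (cong suc (trans (+-comm 1 (a (a p))) (a∘a+1≡b 1≤p)))))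
  (subst (_≤ a (suc (a p))) (trans (+-suc p (a p)) (cong suc (+-comm p (a p))))
    (a<⇒+≤a p (suc (a p)) ≤-refl))

gap-after-a : ∀ {m} → 1 ≤ m → 2 + a (a m) ≤ a (suc (a m))
gap-after-a {m} 1≤m = begin
    2 + a j       ≤⟨ s≤s (≰⇒> λ m+j≤aj → <-irrefl refl (+≤a⇒a< m j 1≤m m+j≤aj)) ⟩
    suc (m + j)   ≡⟨ sym (+-suc m j) ⟩
    m + suc j     ≤⟨ a<⇒+≤a m (suc j) ≤-refl ⟩
    a (suc j)     ∎
  where
  open ≤-Reasoning
  j = a m

gap-after-b : ∀ n → a (suc (b n)) < 2 + a (b n)
gap-after-b n = +-cancelˡ-< n _ _ (begin-strict
    n + a (suc j)     <⟨ b<⇒+a<2* n (suc j) ≤-refl ⟩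
    2 * suc j         ≡⟨ double-suc j ⟩
    2 + 2 * j         ≤⟨ +-monoʳ-≤ 2 (≮⇒≥ λ n+aj<2j → <-irrefl refl (+a<2*⇒b< n j n+aj<2j)) ⟩
    2 + (n + a j)     ≡⟨ +-comm 2 (n + a j) ⟩
    (n + a j) + 2     ≡⟨ +-assoc n (a j) 2 ⟩
    n + (a j + 2)     ≡⟨ cong (_+_ n) (+-comm (a j) 2) ⟩
    n + (2 + a j)     ∎)
  where
  open ≤-Reasoning
  j = b n
  double-suc : ∀ j → 2 * suc j ≡ 2 + 2 * j
  double-suc = solve-∀

a≢b : ∀ m n → 1 ≤ m → a m ≢ b n
a≢b m n 1≤m am≡bn = <⇒≱ (subst (λ j → a (suc j) < 2 + a j) (sym am≡bn) (gap-after-b n)) (gap-after-a 1≤m)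

gap⇒InA : ∀ {j} → 2 + a j ≤ a (suc j) → InA j
gap⇒InA {j} 2+aj≤a[1+j] = m , 1≤m , ≤-antisym (≤-pred am<1+j) j≤am
  where
  m = a (suc j) ∸ suc j
  m+1+j≡a[1+j] : m + suc j ≡ a (suc j)
  m+1+j≡a[1+j] = m∸n+n≡m (n≤a (suc j))
  1+aj≤m+j : suc (a j) ≤ m + j
  1+aj≤m+j = ≤-pred (≤-trans 2+aj≤a[1+j] (≤-reflexive (trans (sym m+1+j≡a[1+j]) (+-suc m j))))
  1≤m : 1 ≤ m
  1≤m = ≰⇒> λ m≤0 → <-irrefl refl (≤-trans 1+aj≤m+j (≤-trans (+-monoˡ-≤ j m≤0) (n≤a j)))
  am<1+j : a m < suc j
  am<1+j = +≤a⇒a< m (suc j) 1≤m (≤-reflexive m+1+j≡a[1+j])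
  j≤am : j ≤ a m
  j≤am = ≮⇒≥ λ am<j → <-irrefl refl (≤-trans 1+aj≤m+j (a<⇒+≤a m j am<j))

no-gap⇒InB : ∀ {j} → 1 ≤ j → a (suc j) ≡ suc (a j) → InB j
no-gap⇒InB {j} 1≤j a[1+j]≡1+aj = m , 1≤m , ≤-antisym (≤-pred bm<1+j) j≤bm
  where
  m = 2 * j ∸ a j
  m+aj≡2j : m + a j ≡ 2 * j
  m+aj≡2j = m∸n+n≡m (<⇒≤ (a<2* 1≤j))
  1≤m : 1 ≤ m
  1≤m = ≰⇒> λ m≤0 → <-irrefl refl
    (≤-trans (a<2* 1≤j) (≤-trans (≤-reflexive (sym m+aj≡2j)) (+-monoˡ-≤ (a j) m≤0)))
  bm<1+j : b m < suc j
  bm<1+j = +a<2*⇒b< m (suc j) (≤-reflexive (begin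
    suc (m + a (suc j))   ≡⟨ cong (λ x → suc (m + x)) a[1+j]≡1+aj ⟩
    suc (m + suc (a j))   ≡⟨ cong suc (+-suc m (a j)) ⟩
    2 + (m + a j)         ≡⟨ cong (_+_ 2) m+aj≡2j ⟩
    2 + 2 * j             ≡⟨ double-suc j ⟩
    2 * suc j             ∎))
    where
    open ≡-Reasoning
    double-suc : ∀ j → 2 + 2 * j ≡ 2 * suc j
    double-suc = solve-∀
  j≤bm : j ≤ b m
  j≤bm = ≮⇒≥ λ bm<j → <-irrefl m+aj≡2j (b<⇒+a<2* m j bm<j)

A⊎B : ∀ j → 1 ≤ j → InA j ⊎ InB j
A⊎B j 1≤j with 2 + a j ≤? a (suc j)
... | yes gap = inj₁ (gap⇒InA gap)
... | no ¬gap = inj₂ (no-gap⇒InB 1≤j (≤-antisym (≤-pred (≰⇒> ¬gap)) (a-suc j)))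

∈-all-upto⇒<length : ∀ (zs : List ℤ) n → (∀ m → m ≤ n → + m ∈ zs) → n < length zs
∈-all-upto⇒<length zs n mem = ≰⇒> λ length≤n →
  let i , j , i<j , same = Fin.pigeonhole (s≤s length≤n) position in
  <-irrefl (ℤ.+-injective (trans (Any.lookup-index (mem′ i)) (trans (cong (lookup zs) same)
                                  (sym (Any.lookup-index (mem′ j)))))) i<j
  where
  mem′ : (i : Fin (suc n)) → + toℕ i ∈ zs
  mem′ i = mem (toℕ i) (Fin.toℕ≤pred[n] i)
  position : Fin (suc n) → Fin (length zs)
  position i = index (mem′ i)

mexAux-spec : ∀ fuel n zs → (∀ m → m < n → + m ∈ zs) → length zs ≤ n + fuel →
              ¬ (+ mexAux fuel n zs ∈ zs) × (∀ m → m < mexAux fuel n zs → + m ∈ zs)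
mexAux-spec zero n zs below length≤n+0 = n∉ , below
  where
  n∉ : ¬ (+ n ∈ zs)
  n∉ n∈ = <⇒≱ (∈-all-upto⇒<length zs n ≤n⇒∈) (subst (length zs ≤_) (+-identityʳ n) length≤n+0)
    where
    ≤n⇒∈ : ∀ m → m ≤ n → + m ∈ zs
    ≤n⇒∈ m m≤n with m≤n⇒m<n∨m≡n m≤n
    ... | inj₁ m<n = below m m<n
    ... | inj₂ refl = n∈
mexAux-spec (suc fuel) n zs below length≤ with any? (λ z → + n ℤ.≟ z) zs
... | yes n∈ = mexAux-spec fuel (suc n) zs below′ (subst (length zs ≤_) (+-suc n fuel) length≤)
  where
  below′ : ∀ m → m < suc n → + m ∈ zs
  below′ m m<1+n with m≤n⇒m<n∨m≡n (m<1+n⇒m≤n m<1+n)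
  ... | inj₁ m<n = below m m<n
  ... | inj₂ refl = n∈
... | no n∉ = n∉ , below

mex∉ : ∀ zs → ¬ (+ mex zs ∈ zs)
mex∉ zs = proj₁ (mexAux-spec (length zs) 0 zs (λ _ ()) ≤-refl)

<mex⇒∈ : ∀ zs m → m < mex zs → + m ∈ zs
<mex⇒∈ zs = proj₂ (mexAux-spec (length zs) 0 zs (λ _ ()) ≤-refl)

mex-unique : ∀ zs c → ¬ (+ c ∈ zs) → (∀ m → m < c → + m ∈ zs) → mex zs ≡ c
mex-unique zs c c∉ below with <-cmp (mex zs) c
... | tri< mex<c _ _ = contradiction (below (mex zs) mex<c) (mex∉ zs)
... | tri≈ _ mex≡c _ = mex≡c
... | tri> _ _ c<mex = contradiction (<mex⇒∈ zs c c<mex) c∉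

rowVals≡applyUpTo : ∀ prev j → rowVals prev j ≡ applyUpTo (rowAt prev) j
rowVals≡applyUpTo prev zero = refl
rowVals≡applyUpTo prev (suc j) =
  trans (cong (_∷ʳ rowAt prev j) (rowVals≡applyUpTo prev j)) (List.applyUpTo-∷ʳ (rowAt prev) j)

rows≡applyUpTo : ∀ i → rows i ≡ applyUpTo qq i
rows≡applyUpTo zero = refl
rows≡applyUpTo (suc i) = trans (cong (_∷ʳ qq i) (rows≡applyUpTo i)) (List.applyUpTo-∷ʳ qq i)

zipWith-applyUpTo : ∀ {A B C : Set} (g : A → B → C) f h n →
                    zipWith g (applyUpTo f n) (applyUpTo h n) ≡ applyUpTo (λ k → g (f k) (h k)) n
zipWith-applyUpTo g f h zero = refl
zipWith-applyUpTo g f h (suc n) = cong (g (f 0) (h 0) ∷_) (zipWith-applyUpTo g (f ∘ suc) (h ∘ suc) n)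

SS≡concatMap : ∀ i j → SS i j ≡ concatMap (λ r → applyUpTo (λ k → + qq i k ℤ.+ + r j ℤ.- + r k) j) (applyUpTo qq i)
SS≡concatMap i j = begin
  concatMap (λ r → zipWith (entry r) (upTo j) (rowVals (rows i) j)) (rows i)
    ≡⟨ cong (concatMap λ r → zipWith (entry r) (upTo j) (rowVals (rows i) j)) (rows≡applyUpTo i) ⟩
  concatMap (λ r → zipWith (entry r) (upTo j) (rowVals (rows i) j)) (applyUpTo qq i)
    ≡⟨ List.concatMap-cong (λ r → trans (cong (zipWith (entry r) (upTo j)) (rowVals≡applyUpTo (rows i) j))
                                          (zipWith-applyUpTo (entry r) id (qq i) j)) (applyUpTo qq i) ⟩
  concatMap (λ r → applyUpTo (λ k → entry r k (qq i k)) j) (applyUpTo qq i) ∎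
  where
  open ≡-Reasoning
  entry : (ℕ → ℕ) → ℕ → ℕ → ℤ
  entry r k x = + x ℤ.+ + r j ℤ.- + r k

∈SS⁻ : ∀ i j {z} → z ∈ SS i j →
       ∃[ l ] ∃[ k ] (l < i × k < j × z ≡ + qq i k ℤ.+ + qq l j ℤ.- + qq l k)
∈SS⁻ i j {z} z∈ with Any.applyUpTo⁻ qq (Any.concatMap⁻ _ (subst (z ∈_) (SS≡concatMap i j) z∈))
... | l , l<i , z∈row with Any.applyUpTo⁻ _ z∈row
... | k , k<j , z≡ = l , k , l<i , k<j , z≡

∈SS⁺ : ∀ i j {l k} → l < i → k < j → + qq i k ℤ.+ + qq l j ℤ.- + qq l k ∈ SS i j
∈SS⁺ i j {l} {k} l<i k<j = subst (entry (qq l) k ∈_) (sym (SS≡concatMap i j))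
  (Any.concatMap⁺ (λ r → applyUpTo (entry r) j) (Any.applyUpTo⁺ qq (Any.applyUpTo⁺ (entry (qq l)) refl k<j) l<i))
  where
  entry : (ℕ → ℕ) → ℕ → ℤ
  entry r k = + qq i k ℤ.+ + r j ℤ.- + r k

+x++y-+w≡+d : ∀ x y w d → d + w ≡ x + y → + x ℤ.+ + y ℤ.- + w ≡ + d
+x++y-+w≡+d x y w d d+w≡x+y = begin
  + (x + y) ℤ.- + w   ≡⟨ ℤ.[+m]-[+n]≡m⊖n (x + y) w ⟩
  (x + y) ℤ.⊖ w       ≡⟨ ℤ.⊖-≥ w≤x+y ⟩
  + (x + y ∸ w)       ≡⟨ cong (λ s → + (s ∸ w)) (sym d+w≡x+y) ⟩
  + (d + w ∸ w)       ≡⟨ cong +_ (m+n∸n≡m d w) ⟩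
  + d                 ∎
  where
  open ≡-Reasoning
  w≤x+y : w ≤ x + y
  w≤x+y = subst (w ≤_) d+w≡x+y (m≤n+m w d)

qq₁≡id : ∀ j → qq 1 j ≡ j
qq₁≡id = <-rec _ λ j ih → mex-unique (SS 1 j) j (j∉ ih) (below ih)
  where
  below : ∀ {j} → (∀ {k} → k < j → qq 1 k ≡ k) → ∀ m → m < j → + m ∈ SS 1 j
  below {j} ih m m<j =
    subst (_∈ SS 1 j) (trans (+x++y-+w≡+d (qq 1 m) 0 0 (qq 1 m) refl) (cong +_ (ih m<j))) (∈SS⁺ 1 j ≤-refl m<j)
  j∉ : ∀ {j} → (∀ {k} → k < j → qq 1 k ≡ k) → ¬ (+ j ∈ SS 1 j)
  j∉ {j} ih j∈ with ∈SS⁻ 1 j j∈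
  ... | zero , k , _ , k<j , j≡ = <-irrefl (sym (trans (ℤ.+-injective (trans j≡ (+x++y-+w≡+d (qq 1 k) 0 0 (qq 1 k) refl))) (ih k<j))) k<j
  ... | suc _ , _ , s≤s () , _

∈S⁻ : ∀ j {z} → z ∈ S j → (∃[ k ] (k < j × z ≡ + q k)) ⊎ InW j z
∈S⁻ j {z} z∈ = by-row (∈SS⁻ 2 j z∈)
  where
  by-row : ∃[ l ] ∃[ k ] (l < 2 × k < j × z ≡ + q k ℤ.+ + qq l j ℤ.- + qq l k) →
           (∃[ k ] (k < j × z ≡ + q k)) ⊎ InW j z
  by-row (zero , k , _ , k<j , z≡) = inj₁ (k , k<j , trans z≡ (+x++y-+w≡+d (q k) 0 0 (q k) refl))
  by-row (suc zero , k , _ , k<j , z≡) =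
    inj₂ (k , k<j , trans z≡ (cong₂ (λ x y → + q k ℤ.+ + x ℤ.- + y) (qq₁≡id j) (qq₁≡id k)))
  by-row (suc (suc _) , _ , s≤s (s≤s ()) , _)

∈S⁺-U : ∀ {j k} → k < j → + q k ∈ S j
∈S⁺-U {j} {k} k<j = subst (_∈ S j) (+x++y-+w≡+d (q k) 0 0 (q k) refl) (∈SS⁺ 2 j {l = 0} (s≤s z≤n) k<j)

∈S⁺-W : ∀ {j z} → InW j z → z ∈ S j
∈S⁺-W {j} (k , k<j , refl) =
  subst (_∈ S j) (cong₂ (λ x y → + q k ℤ.+ + x ℤ.- + y) (qq₁≡id j) (qq₁≡id k)) (∈SS⁺ 2 j {l = 1} ≤-refl k<j)

mfun≤⇒a< : ∀ j x → mfun j ≤ x → a j < j + x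
mfun≤⇒a< j x le = subst₂ _<_ (m∸n+n≡m (n≤a j)) (+-comm x j)
  (+-monoˡ-< j (subst (_≤ x) (+-comm (a j ∸ j) 1) le))

a<⇒mfun≤ : ∀ j x → a j < j + x → mfun j ≤ x
a<⇒mfun≤ j x lt = subst (_≤ x) (+-comm 1 (a j ∸ j))
  (+-cancelʳ-< j (a j ∸ j) x (subst₂ _<_ (sym (m∸n+n≡m (n≤a j))) (+-comm j x) lt))

mfun≤ : ∀ {j} → 1 ≤ j → mfun j ≤ j
mfun≤ {j} 1≤j = a<⇒mfun≤ j j (subst (a j <_) (cong (_+_ j) (+-identityʳ j)) (a<2* 1≤j))

1≤a : ∀ {p} → 1 ≤ p → 1 ≤ a p
1≤a {p} 1≤p = ≤-trans 1≤p (n≤a p)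

1≤b : ∀ {p} → 1 ≤ p → 1 ≤ b p
1≤b {p} 1≤p = ≤-trans (1≤a 1≤p) (m≤m+n (a p) p)

-- {k, v} is {0} or a Wythoff pair {a p, b p}; q turns out to send every k to its partner.
data Partner (k v : ℕ) : Set where
  origin : k ≡ 0 → v ≡ 0 → Partner k v
  a↦b : ∀ p → 1 ≤ p → a p ≡ k → b p ≡ v → Partner k v
  b↦a : ∀ p → 1 ≤ p → b p ≡ k → a p ≡ v → Partner k v

Partner-sym : ∀ {k v} → Partner k v → Partner v k
Partner-sym (origin k≡0 v≡0) = origin v≡0 k≡0
Partner-sym (a↦b p 1≤p ap≡k bp≡v) = b↦a p 1≤p bp≡v ap≡k
Partner-sym (b↦a p 1≤p bp≡k ap≡v) = a↦b p 1≤p ap≡v bp≡k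

Partner-functional : ∀ {k v w} → Partner k v → Partner k w → v ≡ w
Partner-functional (origin refl refl) (origin _ w≡0) = sym w≡0
Partner-functional (origin refl _) (a↦b p 1≤p ap≡0 _) = contradiction ap≡0 (≢-sym (<⇒≢ (1≤a 1≤p)))
Partner-functional (origin refl _) (b↦a p 1≤p bp≡0 _) = contradiction bp≡0 (≢-sym (<⇒≢ (1≤b 1≤p)))
Partner-functional (a↦b p 1≤p refl refl) (origin ap≡0 _) = contradiction ap≡0 (≢-sym (<⇒≢ (1≤a 1≤p)))
Partner-functional (a↦b p 1≤p refl refl) (a↦b p′ _ ap′≡ap refl) = cong b (a-injective {p} {p′} (sym ap′≡ap))
Partner-functional (a↦b p 1≤p refl refl) (b↦a p′ _ bp′≡ap _) = contradiction (sym bp′≡ap) (a≢b p p′ 1≤p)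
Partner-functional (b↦a p 1≤p refl refl) (origin bp≡0 _) = contradiction bp≡0 (≢-sym (<⇒≢ (1≤b 1≤p)))
Partner-functional (b↦a p 1≤p refl refl) (a↦b p′ 1≤p′ ap′≡bp _) = contradiction ap′≡bp (a≢b p′ p 1≤p′)
Partner-functional (b↦a p 1≤p refl refl) (b↦a p′ _ bp′≡bp refl) = cong a (b-injective {p} {p′} (sym bp′≡bp))

partner : ∀ k → ∃[ v ] Partner k v
partner zero = 0 , origin refl refl
partner (suc k) with A⊎B (suc k) (s≤s z≤n)
... | inj₁ (p , 1≤p , ap≡) = b p , a↦b p 1≤p ap≡ refl
... | inj₂ (p , 1≤p , bp≡) = a p , b↦a p 1≤p bp≡ refl

mfun-from : ∀ j x → a j + 1 ≡ x + j → mfun j ≡ x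
mfun-from j x e = begin
  (a j ∸ j) + 1   ≡⟨ sym (+-∸-comm 1 (n≤a j)) ⟩
  (a j + 1) ∸ j   ≡⟨ cong (_∸ j) e ⟩
  (x + j) ∸ j     ≡⟨ m+n∸n≡m x j ⟩
  x               ∎
  where open ≡-Reasoning

mfun∘a : ∀ {p} → 1 ≤ p → mfun (a p) ≡ p
mfun∘a {p} 1≤p = mfun-from (a p) p (trans (a∘a+1≡b 1≤p) (+-comm (a p) p))

mfun∘b : ∀ {p} → 1 ≤ p → mfun (b p) ≡ suc (a p)
mfun∘b {p} 1≤p = mfun-from (b p) (suc (a p))
  (trans (cong (_+ 1) (a∘b≡a+b 1≤p)) (+-comm (a p + b p) 1))

module PartnersBelow (j : ℕ) (ih : ∀ {k} → k < j → Partner k (q k)) where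

  q≡partner : ∀ {k v} → Partner k v → v < j → q v ≡ k
  q≡partner kv v<j = Partner-functional (ih v<j) (Partner-sym kv)

  partner<⇒∈U : ∀ {y k} → Partner y k → k < j → InU j y
  partner<⇒∈U yk k<j = _ , k<j , q≡partner yk k<j

  ∈U⇒partner< : ∀ {y k} → InU j y → Partner y k → k < j
  ∈U⇒partner< (k′ , k′<j , refl) yk = subst (_< j) (Partner-functional (Partner-sym (ih k′<j)) yk) k′<j

  ∈U⇒∈S : ∀ {y} → InU j y → + y ∈ S j
  ∈U⇒∈S (k , k<j , refl) = ∈S⁺-U k<j

  -- q k + j − k is j, j + p or j − p according as k is 0, a p or b p.
  W⇒range : 1 ≤ j → ∀ {z} → InW j z → ∃[ x ] (z ≡ + x × mfun j ≤ x × x ≤ a j)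
  W⇒range 1≤j (k , k<j , refl) with ih k<j
  ... | origin refl _ = j , +x++y-+w≡+d 0 j 0 j (+-identityʳ j) , mfun≤ 1≤j , n≤a j
  ... | a↦b p 1≤p refl bp≡qk = p + j
    , +x++y-+w≡+d (q (a p)) j (a p) (p + j) (trans (regroup p j (a p)) (cong (_+ j) bp≡qk))
    , ≤-trans (mfun≤ 1≤j) (m≤n+m j p)
    , a<⇒+≤a p j k<j
    where
    regroup : ∀ p j x → p + j + x ≡ x + p + j
    regroup = solve-∀
  ... | b↦a p 1≤p refl ap≡qk with m≤n⇒∃[o]m+o≡n (≤-trans (m≤n+m p (a p)) (<⇒≤ k<j))
  ...   | d , refl = d
    , +x++y-+w≡+d (q (b p)) (p + d) (b p) d (trans (regroup d p (a p)) (cong (_+ (p + d)) ap≡qk))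
    , a<⇒mfun≤ (p + d) d (+-cancelˡ-< p _ _ (subst (p + a (p + d) <_) (double p d) (b<⇒+a<2* p (p + d) k<j)))
    , ≤-trans (m≤n+m d p) (n≤a (p + d))
    where
    regroup : ∀ d p x → d + (x + p) ≡ x + (p + d)
    regroup = solve-∀
    double : ∀ p d → 2 * (p + d) ≡ p + ((p + d) + d)
    double = solve-∀

  range⇒W : 1 ≤ j → ∀ x → mfun j ≤ x → x ≤ a j → InW j (+ x)
  range⇒W 1≤j x lo hi with <-cmp x j
  ... | tri≈ _ refl _ = 0 , 1≤j , sym (+x++y-+w≡+d 0 x 0 x (+-identityʳ x))
  ... | tri> _ _ j<x with m≤n⇒∃[o]m+o≡n (<⇒≤ j<x)
  ...   | p , refl = a p , ap<j
    , sym (trans (cong (λ v → + v ℤ.+ + j ℤ.- + a p) (q≡partner (b↦a p 1≤p refl refl) ap<j))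
                 (+x++y-+w≡+d (b p) j (a p) (j + p) (regroup j p (a p))))
    where
    regroup : ∀ j p x → j + p + x ≡ x + p + j
    regroup = solve-∀
    1≤p : 1 ≤ p
    1≤p = +-cancelˡ-< j 0 p (subst (_< j + p) (sym (+-identityʳ j)) j<x)
    ap<j : a p < j
    ap<j = +≤a⇒a< p j 1≤p (subst (_≤ a j) (+-comm j p) hi)
  range⇒W 1≤j x lo hi | tri< x<j _ _ with m≤n⇒∃[o]m+o≡n (<⇒≤ x<j)
  ... | p , refl = b p , bp<j
    , sym (trans (cong (λ v → + v ℤ.+ + (x + p) ℤ.- + b p) (q≡partner (a↦b p 1≤p refl refl) bp<j))
                 (+x++y-+w≡+d (a p) (x + p) (b p) x (regroup x p (a p))))
    where
    regroup : ∀ x p y → x + (y + p) ≡ y + (x + p)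
    regroup = solve-∀
    double : ∀ x p → p + ((x + p) + x) ≡ 2 * (x + p)
    double = solve-∀
    1≤p : 1 ≤ p
    1≤p = +-cancelˡ-< x 0 p (subst (_< x + p) (sym (+-identityʳ x)) x<j)
    bp<j : b p < x + p
    bp<j = +a<2*⇒b< p (x + p) (subst (p + a (x + p) <_) (double x p) (+-monoʳ-< p (mfun≤⇒a< (x + p) x lo)))

partner<a : ∀ {m k p} → 1 ≤ p → Partner m k → m < p → k < a p
partner<a 1≤p (origin refl refl) _ = 1≤a 1≤p
partner<a {p = p} 1≤p (a↦b r _ refl refl) ar<p = +a<2*⇒b< r (a p) (begin
    suc (r + a (a p))     ≡⟨ +-comm 1 (r + a (a p)) ⟩
    r + a (a p) + 1       ≡⟨ +-assoc r (a (a p)) 1 ⟩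
    r + (a (a p) + 1)     ≡⟨ cong (_+_ r) (a∘a+1≡b 1≤p) ⟩
    r + (a p + p)         ≡⟨ regroup r (a p) p ⟩
    (r + p) + a p         ≤⟨ +-monoˡ-≤ (a p) (a<⇒+≤a r p ar<p) ⟩
    a p + a p             ≡⟨ cong (_+_ (a p)) (sym (+-identityʳ (a p))) ⟩
    2 * a p               ∎)
  where
  open ≤-Reasoning
  regroup : ∀ r x p → r + (x + p) ≡ (r + p) + x
  regroup = solve-∀
partner<a {p = p} _ (b↦a r _ refl refl) br<p = <-≤-trans (≤-<-trans (m≤m+n (a r) r) br<p) (n≤a p)

partner<b : ∀ {m k p} → 1 ≤ p → Partner m k → m < a p → k < b p
partner<b 1≤p (origin refl refl) _ = 1≤b 1≤p
partner<b {p = p} _ (a↦b r _ refl refl) ar<ap = b-strict (a-cancel-< {r} {p} ar<ap)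
partner<b {p = p} _ (b↦a r _ refl refl) br<ap = <-≤-trans (≤-<-trans (m≤m+n (a r) r) br<ap) (m≤m+n (a p) p)

q∘a≡b-step : ∀ {p} → 1 ≤ p → (∀ {k} → k < a p → Partner k (q k)) → q (a p) ≡ b p
q∘a≡b-step {p} 1≤p ih = mex-unique (S (a p)) (b p) bp∉ below
  where
  open PartnersBelow (a p) ih
  bp∉ : ¬ (+ b p ∈ S (a p))
  bp∉ bp∈ = [ not-U , not-W ]′ (∈S⁻ (a p) bp∈)
    where
    not-U : ¬ (∃[ k ] (k < a p × + b p ≡ + q k))
    not-U (k , k<ap , bp≡qk) =
      <-irrefl refl (∈U⇒partner< (k , k<ap , sym (ℤ.+-injective bp≡qk)) (b↦a p 1≤p refl refl))
    not-W : ¬ InW (a p) (+ b p)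
    not-W w = let _ , bp≡x , _ , x≤a[ap] = W⇒range (1≤a 1≤p) w in
      <⇒≱ (subst (a (a p) <_) (a∘a+1≡b 1≤p) (m<m+n (a (a p)) (s≤s z≤n)))
          (subst (_≤ a (a p)) (sym (ℤ.+-injective bp≡x)) x≤a[ap])
  below : ∀ m → m < b p → + m ∈ S (a p)
  below m m<bp = in-W-or-U (mfun (a p) ≤? m)
    where
    in-W-or-U : Dec (mfun (a p) ≤ m) → + m ∈ S (a p)
    in-W-or-U (yes lo) = ∈S⁺-W (range⇒W (1≤a 1≤p) m lo
      (m<1+n⇒m≤n (subst (m <_) (sym (trans (+-comm 1 (a (a p))) (a∘a+1≡b 1≤p))) m<bp)))
    in-W-or-U (no ¬lo) = let k , mk = partner m in
      ∈U⇒∈S (partner<⇒∈U mk (partner<a 1≤p mk (subst (m <_) (mfun∘a 1≤p) (≰⇒> ¬lo))))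

q∘b≡a-step : ∀ {p} → 1 ≤ p → (∀ {k} → k < b p → Partner k (q k)) → q (b p) ≡ a p
q∘b≡a-step {p} 1≤p ih = mex-unique (S (b p)) (a p) ap∉ below
  where
  open PartnersBelow (b p) ih
  ap∉ : ¬ (+ a p ∈ S (b p))
  ap∉ ap∈ = [ not-U , not-W ]′ (∈S⁻ (b p) ap∈)
    where
    not-U : ¬ (∃[ k ] (k < b p × + a p ≡ + q k))
    not-U (k , k<bp , ap≡qk) =
      <-irrefl refl (∈U⇒partner< (k , k<bp , sym (ℤ.+-injective ap≡qk)) (a↦b p 1≤p refl refl))
    not-W : ¬ InW (b p) (+ a p)
    not-W w = let x , ap≡x , mfun≤x , _ = W⇒range (1≤b 1≤p) w in
      <-irrefl (ℤ.+-injective ap≡x) (subst (_≤ x) (mfun∘b 1≤p) mfun≤x)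
  below : ∀ m → m < a p → + m ∈ S (b p)
  below m m<ap = let k , mk = partner m in ∈U⇒∈S (partner<⇒∈U mk (partner<b 1≤p mk m<ap))

q-partner : ∀ j → Partner j (q j)
q-partner = <-rec _ step
  where
  step : ∀ j → (∀ {k} → k < j → Partner k (q k)) → Partner j (q j)
  step j ih with partner j
  ... | _ , origin refl _ = origin refl refl
  ... | _ , a↦b p 1≤p refl _ = a↦b p 1≤p refl (sym (q∘a≡b-step 1≤p ih))
  ... | _ , b↦a p 1≤p refl _ = b↦a p 1≤p refl (sym (q∘b≡a-step 1≤p ih))

module Partners (j : ℕ) = PartnersBelow j (λ {k} _ → q-partner k)

+≤-between : ∀ {lo hi x z} → z ≡ + x → lo ≤ x → x ≤ hi → + lo ℤ.≤ z × z ℤ.≤ + hi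
+≤-between refl lo≤x x≤hi = ℤ.+≤+ lo≤x , ℤ.+≤+ x≤hi

W≡range : ∀ {j} → 1 ≤ j → ∀ z → InW j z ⇔ (+ mfun j ℤ.≤ z × z ℤ.≤ + a j)
W≡range {j} 1≤j z = mk⇔ to from
  where
  to : InW j z → + mfun j ℤ.≤ z × z ℤ.≤ + a j
  to w = let _ , z≡x , lo , hi = Partners.W⇒range j 1≤j w in +≤-between z≡x lo hi
  from : + mfun j ℤ.≤ z × z ℤ.≤ + a j → InW j z
  from (ℤ.+≤+ lo , ℤ.+≤+ hi) = Partners.range⇒W j 1≤j _ lo hi

q≤a+1 : ∀ k → q k ≤ a k + 1
q≤a+1 k with q-partner k
... | origin _ q≡0 = ≤-trans (≤-reflexive q≡0) z≤n
... | a↦b p 1≤p refl bp≡q = ≤-reflexive (trans (sym bp≡q) (sym (a∘a+1≡b 1≤p)))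
... | b↦a p 1≤p refl ap≡q = ≤-trans (≤-reflexive (sym ap≡q))
  (≤-trans (m≤m+n (a p) p) (≤-trans (n≤a (b p)) (m≤m+n (a (b p)) 1)))

∈S⇒range : ∀ j {z} → z ∈ S j → ∃[ x ] (z ≡ + x × x ≤ a j)
∈S⇒range j z∈ = [ from-U , from-W ]′ (∈S⁻ j z∈)
  where
  from-U : ∀ {z} → ∃[ k ] (k < j × z ≡ + q k) → ∃[ x ] (z ≡ + x × x ≤ a j)
  from-U (k , k<j , z≡qk) = q k , z≡qk , ≤-trans (q≤a+1 k) (subst (_≤ a j) (+-comm 1 (a k)) (a-strict k<j))
  from-W : ∀ {z} → InW j z → ∃[ x ] (z ≡ + x × x ≤ a j)
  from-W w@(_ , k<j , _) = let x , z≡x , _ , x≤aj = Partners.W⇒range j (≤-trans (s≤s z≤n) k<j) w in x , z≡x , x≤aj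

q∘a≡b : ∀ {p} → 1 ≤ p → q (a p) ≡ b p
q∘a≡b {p} 1≤p = Partner-functional (q-partner (a p)) (a↦b p 1≤p refl refl)

q∘b≡a : ∀ {p} → 1 ≤ p → q (b p) ≡ a p
q∘b≡a {p} 1≤p = Partner-functional (q-partner (b p)) (b↦a p 1≤p refl refl)

q-on-A : ∀ {j} → InA j → q j ≡ a j + 1
q-on-A (p , 1≤p , refl) = trans (q∘a≡b 1≤p) (sym (a∘a+1≡b 1≤p))

q-on-B : ∀ {j} → InB j → q j ≡ floorφ-1 j
q-on-B (p , 1≤p , refl) = trans (q∘b≡a 1≤p) (sym (trans (cong (_∸ b p) (a∘b≡a+b 1≤p)) (m+n∸n≡m (a p) (b p))))

S-on-A : ∀ {j} → InA j → ∀ z → z ∈ S j ⇔ (+ 0 ℤ.≤ z × z ℤ.≤ + a j)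
S-on-A {j} j∈A z = mk⇔ to from
  where
  to : z ∈ S j → + 0 ℤ.≤ z × z ℤ.≤ + a j
  to z∈ = let _ , z≡x , x≤aj = ∈S⇒range j z∈ in +≤-between z≡x z≤n x≤aj
  from : + 0 ℤ.≤ z × z ℤ.≤ + a j → z ∈ S j
  from (ℤ.+≤+ _ , ℤ.+≤+ {x} x≤aj) =
    <mex⇒∈ (S j) x (subst (x <_) (sym (trans (q-on-A j∈A) (+-comm (a j) 1))) (s≤s x≤aj))

S-on-B : ∀ {j} → InB j → ∀ z → z ∈ S j ⇔ (+ 0 ℤ.≤ z × z ℤ.≤ + a j × z ≢ + floorφ-1 j)
S-on-B {j} j∈B@(p , 1≤p , bp≡j) z = mk⇔ to from
  where
  to : z ∈ S j → + 0 ℤ.≤ z × z ℤ.≤ + a j × z ≢ + floorφ-1 j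
  to z∈ = let _ , z≡x , x≤aj = ∈S⇒range j z∈ ; lo , hi = +≤-between z≡x z≤n x≤aj in
    lo , hi , λ z≡ → mex∉ (S j) (subst (_∈ S j) (trans z≡ (cong +_ (sym (q-on-B j∈B)))) z∈)
  from : + 0 ℤ.≤ z × z ℤ.≤ + a j × z ≢ + floorφ-1 j → z ∈ S j
  from (ℤ.+≤+ _ , ℤ.+≤+ {x} x≤aj , x≢) = by-cmp (<-cmp x (q j))
    where
    by-cmp : Tri (x < q j) (x ≡ q j) (q j < x) → + x ∈ S j
    by-cmp (tri< x<qj _ _) = <mex⇒∈ (S j) x x<qj
    by-cmp (tri≈ _ x≡qj _) = contradiction (cong +_ (trans x≡qj (q-on-B j∈B))) x≢
    by-cmp (tri> _ _ qj<x) = ∈S⁺-W (Partners.range⇒W j (subst (1 ≤_) bp≡j (1≤b 1≤p)) x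
      (subst (_≤ x) (trans (+-comm 1 (q j)) (cong (_+ 1) (q-on-B j∈B))) qj<x) x≤aj)

leastB≥ : ℕ → ℕ
leastB≥ j = 2 * j ∸ a j

leastB≥+a≡2* : ∀ {j} → 1 ≤ j → leastB≥ j + a j ≡ 2 * j
leastB≥+a≡2* 1≤j = m∸n+n≡m (<⇒≤ (a<2* 1≤j))

leastB≥-from : ∀ {j x} → 1 ≤ j → x + a j ≡ 2 * j → leastB≥ j ≡ x
leastB≥-from {j} {x} 1≤j e = +-cancelʳ-≡ (a j) _ _ (trans (leastB≥+a≡2* 1≤j) (sym e))

b<⇒<leastB≥ : ∀ {j} m → 1 ≤ j → b m < j → m < leastB≥ j
b<⇒<leastB≥ {j} m 1≤j bm<j =
  +-cancelʳ-< (a j) m (leastB≥ j) (subst (m + a j <_) (sym (leastB≥+a≡2* 1≤j)) (b<⇒+a<2* m j bm<j))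

<leastB≥⇒b< : ∀ {j} m → 1 ≤ j → m < leastB≥ j → b m < j
<leastB≥⇒b< {j} m 1≤j m<B =
  +a<2*⇒b< m j (subst (m + a j <_) (leastB≥+a≡2* 1≤j) (+-monoˡ-< (a j) m<B))

1≤leastB≥ : ∀ {j} → 1 ≤ j → 1 ≤ leastB≥ j
1≤leastB≥ 1≤j = b<⇒<leastB≥ 0 1≤j 1≤j

+leastB≥≤⇒a< : ∀ {j} m → 1 ≤ j → 1 ≤ m → m + leastB≥ j ≤ j → a m < j
+leastB≥≤⇒a< {j} m 1≤j 1≤m m+B≤j = +≤a⇒a< m j 1≤m (+-cancelʳ-≤ (leastB≥ j) (m + j) (a j) (begin
    m + j + leastB≥ j     ≡⟨ regroup m j (leastB≥ j) ⟩
    m + leastB≥ j + j     ≤⟨ +-monoˡ-≤ j m+B≤j ⟩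
    j + j                 ≡⟨ cong (_+_ j) (sym (+-identityʳ j)) ⟩
    2 * j                 ≡⟨ sym (leastB≥+a≡2* 1≤j) ⟩
    leastB≥ j + a j       ≡⟨ +-comm (leastB≥ j) (a j) ⟩
    a j + leastB≥ j       ∎))
  where
  open ≤-Reasoning
  regroup : ∀ m j B → m + j + B ≡ m + B + j
  regroup = solve-∀

b<a⇒+≤a : ∀ m {B} → 1 ≤ B → b m < a B → m + B ≤ a B
b<a⇒+≤a m {B} 1≤B bm<aB = +-cancelʳ-≤ (a B) (m + B) (a B) (begin
    m + B + a B       ≡⟨ +-assoc m B (a B) ⟩
    m + (B + a B)     ≡⟨ cong (_+_ m) (sym (trans (a∘a+1≡b 1≤B) (+-comm (a B) B))) ⟩
    m + (a (a B) + 1) ≡⟨ +-comm m (a (a B) + 1) ⟩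
    a (a B) + 1 + m   ≡⟨ cong (_+ m) (+-comm (a (a B)) 1) ⟩
    suc (a (a B) + m) ≡⟨ cong suc (+-comm (a (a B)) m) ⟩
    suc (m + a (a B)) ≤⟨ b<⇒+a<2* m (a B) bm<aB ⟩
    2 * a B           ≡⟨ cong (_+_ (a B)) (+-identityʳ (a B)) ⟩
    a B + a B         ∎)
  where open ≤-Reasoning

+≤a⇒b<a : ∀ m {B} → 1 ≤ B → m + B ≤ a B → b m < a B
+≤a⇒b<a m {B} 1≤B m+B≤aB = +a<2*⇒b< m (a B) (begin
    suc (m + a (a B)) ≡⟨ cong suc (+-comm m (a (a B))) ⟩
    suc (a (a B) + m) ≡⟨ cong (_+ m) (trans (+-comm 1 (a (a B))) (trans (a∘a+1≡b 1≤B) (+-comm (a B) B))) ⟩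
    B + a B + m       ≡⟨ regroup B (a B) m ⟩
    m + B + a B       ≤⟨ +-monoˡ-≤ (a B) m+B≤aB ⟩
    a B + a B         ≡⟨ cong (_+_ (a B)) (sym (+-identityʳ (a B))) ⟩
    2 * a B           ∎)
  where
  open ≤-Reasoning
  regroup : ∀ B x m → B + x + m ≡ m + B + x
  regroup = solve-∀

a∘leastB≥≤ : ∀ {j} → 1 ≤ j → a (leastB≥ j) ≤ j
a∘leastB≥≤ {j} 1≤j = bound (leastB≥ j) (λ m m<B → <leastB≥⇒b< m 1≤j m<B)
  where
  bound : ∀ B → (∀ m → m < B → b m < j) → a B ≤ j
  bound zero _ = z≤n
  bound (suc zero) _ = 1≤j
  bound (suc (suc B)) b< = begin
    a (suc (suc B))       ≤⟨ a-suc≤ (suc B) ⟩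
    2 + a (suc B)         ≡⟨ +-comm 2 (a (suc B)) ⟩
    a (suc B) + 2         ≤⟨ +-monoʳ-≤ (a (suc B)) (s≤s (s≤s z≤n)) ⟩
    a (suc B) + suc (suc B) ≡⟨ +-suc (a (suc B)) (suc B) ⟩
    suc (b (suc B))       ≤⟨ b< (suc B) ≤-refl ⟩
    j                     ∎
    where open ≤-Reasoning

partner<j : ∀ {j y k} → 1 ≤ j → y < a (leastB≥ j) → Partner y k → k < j
partner<j 1≤j _ (origin refl refl) = 1≤j
partner<j {j} 1≤j ar<aB (a↦b r _ refl refl) = <leastB≥⇒b< r 1≤j (a-cancel-< {r} {leastB≥ j} ar<aB)
partner<j {j} 1≤j br<aB (b↦a r 1≤r refl refl) =
  +leastB≥≤⇒a< r 1≤j 1≤r (≤-trans (b<a⇒+≤a r (1≤leastB≥ 1≤j) br<aB) (a∘leastB≥≤ 1≤j))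

<a∘leastB≥⇒∈U : ∀ {j y} → 1 ≤ j → y < a (leastB≥ j) → InU j y
<a∘leastB≥⇒∈U {j} {y} 1≤j y<aB = let k , yk = partner y in Partners.partner<⇒∈U j yk (partner<j 1≤j y<aB yk)

a∘leastB≥∉U : ∀ {j} → 1 ≤ j → ¬ InU j (a (leastB≥ j))
a∘leastB≥∉U {j} 1≤j aB∈U = <-irrefl refl
  (b<⇒<leastB≥ (leastB≥ j) 1≤j (Partners.∈U⇒partner< j aB∈U (a↦b (leastB≥ j) (1≤leastB≥ 1≤j) refl refl)))

∈U-above-a∘leastB≥ : ∀ {j y} → 1 ≤ j → InU j y → a (leastB≥ j) < y → ∃[ m ] (1 ≤ m × b m ≡ y × a m < j)
∈U-above-a∘leastB≥ {j} {y} 1≤j y∈U aB<y with partner y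
... | _ , origin refl _ = contradiction aB<y λ ()
... | _ , yk@(a↦b r _ refl refl) = contradiction (b<⇒<leastB≥ r 1≤j (Partners.∈U⇒partner< j y∈U yk))
  (<⇒≯ (a-cancel-< {leastB≥ j} {r} aB<y))
... | _ , yk@(b↦a r 1≤r refl refl) = r , 1≤r , refl , Partners.∈U⇒partner< j y∈U yk

b∈U : ∀ {j m} → 1 ≤ m → a m < j → InU j (b m)
b∈U {j} {m} 1≤m am<j = Partners.partner<⇒∈U j (b↦a m 1≤m refl refl) am<j

IsN⇒suc≡a∘leastB≥ : ∀ {j n} → 1 ≤ j → IsN j n → suc n ≡ a (leastB≥ j)
IsN⇒suc≡a∘leastB≥ {j} {n} 1≤j (≤n⇒∈U , 1+n∉U) with <-cmp (suc n) (a (leastB≥ j))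
... | tri< 1+n<aB _ _ = contradiction (<a∘leastB≥⇒∈U 1≤j 1+n<aB) 1+n∉U
... | tri≈ _ 1+n≡aB _ = 1+n≡aB
... | tri> _ _ aB<1+n = contradiction (≤n⇒∈U _ (m<1+n⇒m≤n aB<1+n)) (a∘leastB≥∉U 1≤j)

n-on-T₁ : ∀ {j} → InT₁ j → ∀ n → IsN j n → n + 2 ≡ mfun j
n-on-T₁ (p , 1≤p , refl) n isN = begin
  n + 2                     ≡⟨ +-comm n 2 ⟩
  suc (suc n)               ≡⟨ cong suc (IsN⇒suc≡a∘leastB≥ (1≤b 1≤p) isN) ⟩
  suc (a (leastB≥ (b p)))   ≡⟨ cong (suc ∘ a) (leastB≥-from (1≤b 1≤p) p+a∘b≡2b) ⟩
  suc (a p)                 ≡⟨ sym (mfun∘b 1≤p) ⟩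
  mfun (b p)                ∎
  where
  open ≡-Reasoning
  regroup : ∀ p x → p + (x + (x + p)) ≡ 2 * (x + p)
  regroup = solve-∀
  p+a∘b≡2b : p + a (b p) ≡ 2 * b p
  p+a∘b≡2b = trans (cong (_+_ p) (a∘b≡a+b 1≤p)) (regroup p (a p))

n-on-T₂ : ∀ {j} → InT₂ j → ∀ n → IsN j n → n + 1 ≡ mfun j
n-on-T₂ {j} (p , 1≤p , bp∸1≡j) n isN = begin
  n + 1                     ≡⟨ +-comm n 1 ⟩
  suc n                     ≡⟨ IsN⇒suc≡a∘leastB≥ 1≤j isN ⟩
  a (leastB≥ j)             ≡⟨ cong a (leastB≥-from 1≤j p+a∘j≡2j) ⟩
  a p                       ≡⟨ sym (mfun∘a (1≤a 1≤p)) ⟩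
  mfun (a (a p))            ≡⟨ cong mfun (sym j≡a∘a) ⟩
  mfun j                    ∎
  where
  open ≡-Reasoning
  j≡a∘a : j ≡ a (a p)
  j≡a∘a = trans (sym bp∸1≡j) (trans (cong (_∸ 1) (sym (a∘a+1≡b 1≤p))) (m+n∸n≡m (a (a p)) 1))
  1≤j : 1 ≤ j
  1≤j = subst (1 ≤_) (sym j≡a∘a) (1≤a (1≤a 1≤p))
  p+a∘j≡2j : p + a j ≡ 2 * j
  p+a∘j≡2j = +-cancelʳ-≡ 1 _ _ (begin
    p + a j + 1           ≡⟨ +-assoc p (a j) 1 ⟩
    p + (a j + 1)         ≡⟨ cong (λ x → p + (a x + 1)) j≡a∘a ⟩
    p + (a (a (a p)) + 1) ≡⟨ cong (_+_ p) (a∘a+1≡b (1≤a 1≤p)) ⟩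
    p + (a (a p) + a p)   ≡⟨ regroup p (a (a p)) (a p) ⟩
    a (a p) + (a p + p)   ≡⟨ cong (_+_ (a (a p))) (sym (a∘a+1≡b 1≤p)) ⟩
    a (a p) + (a (a p) + 1) ≡⟨ double (a (a p)) ⟩
    2 * a (a p) + 1       ≡⟨ cong (λ x → 2 * x + 1) (sym j≡a∘a) ⟩
    2 * j + 1             ∎)
    where
    regroup : ∀ p x y → p + (x + y) ≡ x + (y + p)
    regroup = solve-∀
    double : ∀ x → x + (x + 1) ≡ 2 * x + 1
    double = solve-∀

n-on-T₃ : ∀ {j} → InT₃ j → ∀ n → IsN j n → n ≡ mfun j
n-on-T₃ {j} (p , 1≤p , 2ap+p≡j) n isN = suc-injective (begin
  suc n                     ≡⟨ IsN⇒suc≡a∘leastB≥ 1≤j isN ⟩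
  a (leastB≥ j)             ≡⟨ cong a (leastB≥-from 1≤j 1+ap+a∘j≡2j) ⟩
  a (suc (a p))             ≡⟨ a∘suc∘a≡suc∘b 1≤p ⟩
  suc (b p)                 ≡⟨ cong suc (sym (mfun∘a (1≤b 1≤p))) ⟩
  suc (mfun (a (b p)))      ≡⟨ cong (suc ∘ mfun) (sym j≡a∘b) ⟩
  suc (mfun j)              ∎)
  where
  open ≡-Reasoning
  j≡a∘b : j ≡ a (b p)
  j≡a∘b = trans (sym 2ap+p≡j) (trans (regroup (a p) p) (sym (a∘b≡a+b 1≤p)))
    where
    regroup : ∀ x p → 2 * x + p ≡ x + (x + p)
    regroup = solve-∀
  1≤j : 1 ≤ j
  1≤j = subst (1 ≤_) (sym j≡a∘b) (1≤a (1≤b 1≤p))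
  1+ap+a∘j≡2j : suc (a p) + a j ≡ 2 * j
  1+ap+a∘j≡2j = begin
    suc (a p) + a j           ≡⟨ cong (λ x → suc (a p) + a x) j≡a∘b ⟩
    suc (a p) + a (a (b p))   ≡⟨ regroup (a p) (a (a (b p))) ⟩
    a p + (a (a (b p)) + 1)   ≡⟨ cong (_+_ (a p)) (a∘a+1≡b (1≤b 1≤p)) ⟩
    a p + (a (b p) + b p)     ≡⟨ cong (λ x → a p + (x + b p)) (a∘b≡a+b 1≤p) ⟩
    a p + ((a p + b p) + b p) ≡⟨ double (a p) (b p) ⟩
    2 * (a p + b p)           ≡⟨ cong (2 *_) (sym j≡a∘b′) ⟩
    2 * j                     ∎
    where
    regroup : ∀ x y → suc x + y ≡ x + (y + 1)
    regroup = solve-∀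
    double : ∀ x y → x + ((x + y) + y) ≡ 2 * (x + y)
    double = solve-∀
    j≡a∘b′ : j ≡ a p + b p
    j≡a∘b′ = trans j≡a∘b (a∘b≡a+b 1≤p)

nth-++ˡ : ∀ i (xs ys : List ℕ) {v} → nth i xs ≡ just v → nth i (xs ++ ys) ≡ just v
nth-++ˡ zero (x ∷ xs) ys e = e
nth-++ˡ (suc i) (x ∷ xs) ys e = nth-++ˡ i xs ys e

nth-length : ∀ (xs : List ℕ) x ys → nth (length xs) (xs ++ x ∷ ys) ≡ just x
nth-length [] x ys = refl
nth-length (_ ∷ xs) x ys = nth-length xs x ys

∈⇒≤foldr-⊔ : ∀ {x} (xs : List ℕ) → x ∈ xs → x ≤ foldr _⊔_ 0 xs
∈⇒≤foldr-⊔ (y ∷ xs) (here refl) = m≤m⊔n y _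
∈⇒≤foldr-⊔ (y ∷ xs) (there x∈) = ≤-trans (∈⇒≤foldr-⊔ xs x∈) (m≤n⊔m y _)

module SortedFilter {P : Pred ℕ 0ℓ} (P? : Decidable P) where

  rank : ℕ → ℕ
  rank y = length (filter P? (upTo y))

  filter-upTo-suc : ∀ y → filter P? (upTo (suc y)) ≡ filter P? (upTo y) ++ filter P? (y ∷ [])
  filter-upTo-suc y = trans (cong (filter P?) (sym (List.upTo-∷ʳ y))) (List.filter-++ P? (upTo y) (y ∷ []))

  rank-accept : ∀ {y} → P y → rank (suc y) ≡ suc (rank y)
  rank-accept {y} py = trans (cong length (filter-upTo-suc y)) (trans (List.length-++ (filter P? (upTo y)))
    (trans (cong (λ l → rank y + length l) (List.filter-accept P? py)) (+-comm (rank y) 1)))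

  rank-reject : ∀ {y} → ¬ P y → rank (suc y) ≡ rank y
  rank-reject {y} ¬py = trans (cong length (filter-upTo-suc y)) (trans (List.length-++ (filter P? (upTo y)))
    (trans (cong (λ l → rank y + length l) (List.filter-reject P? ¬py)) (+-identityʳ (rank y))))

  rank-all : ∀ t → (∀ y → y < t → P y) → rank t ≡ t
  rank-all zero _ = refl
  rank-all (suc t) all = trans (rank-accept (all t ≤-refl)) (cong suc (rank-all t λ y y<t → all y (m<n⇒m<1+n y<t)))

  rank-gap : ∀ {lo hi} → lo ≤ hi → (∀ y → lo ≤ y → y < hi → ¬ P y) → rank hi ≡ rank lo
  rank-gap {hi = zero} z≤n _ = refl
  rank-gap {lo} {suc hi} lo≤1+hi none with m≤n⇒m<n∨m≡n lo≤1+hi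
  ... | inj₂ refl = refl
  ... | inj₁ lo<1+hi = trans (rank-reject (none hi (m<1+n⇒m≤n lo<1+hi) ≤-refl))
    (rank-gap (m<1+n⇒m≤n lo<1+hi) λ y lo≤y y<hi → none y lo≤y (m<n⇒m<1+n y<hi))

  nth-rank : ∀ M {x} → x < M → P x → nth (rank x) (filter P? (upTo M)) ≡ just x
  nth-rank (suc M) {x} x<1+M px with m≤n⇒m<n∨m≡n (m<1+n⇒m≤n x<1+M)
  ... | inj₁ x<M = trans (cong (nth (rank x)) (filter-upTo-suc M)) (nth-++ˡ (rank x) (filter P? (upTo M)) _ (nth-rank M x<M px))
  ... | inj₂ refl = trans (cong (nth (rank x)) (filter-upTo-suc x))
    (trans (cong (λ l → nth (rank x) (filter P? (upTo x) ++ l)) (List.filter-accept P? px)) (nth-length (filter P? (upTo x)) x []))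

∈Ulist⇒InU : ∀ {j x} → x ∈ Ulist j → InU j x
∈Ulist⇒InU {j} {x} x∈ =
  let k , k<j , x≡qk = Any.applyUpTo⁻ q (subst (x ∈_) (rowVals≡applyUpTo (rows 2) j) x∈) in k , k<j , sym x≡qk

InU⇒∈Ulist : ∀ {j x} → InU j x → x ∈ Ulist j
InU⇒∈Ulist {j} (k , k<j , refl) = subst (q k ∈_) (sym (rowVals≡applyUpTo (rows 2) j)) (Any.applyUpTo⁺ q refl k<j)

leastK+leastB≥ : ∀ {j n k} → 1 ≤ j → IsN j n → IsLeastK n k → k + leastB≥ j ≡ suc (suc n)
leastK+leastB≥ {j} {n} {k} 1≤j isN (1≤k , n<bk , least) = ≤-antisym (upper k 1≤k least) lower
  where
  B = leastB≥ j
  1+n≡aB : suc n ≡ a B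
  1+n≡aB = IsN⇒suc≡a∘leastB≥ 1≤j isN
  lower : suc (suc n) ≤ k + B
  lower = subst (λ x → suc x ≤ k + B) (sym 1+n≡aB)
    (≰⇒> λ k+B≤aB → <⇒≱ n<bk (m<1+n⇒m≤n (subst (b k <_) (sym 1+n≡aB) (+≤a⇒b<a k (1≤leastB≥ 1≤j) k+B≤aB))))
  upper : ∀ k → 1 ≤ k → (∀ k′ → 1 ≤ k′ → k′ < k → b k′ ≤ n) → k + B ≤ suc (suc n)
  upper (suc zero) _ _ = s≤s (subst (B ≤_) (sym 1+n≡aB) (n≤a B))
  upper (suc (suc k′)) _ least = s≤s (subst (suc k′ + B ≤_) (sym 1+n≡aB)
    (b<a⇒+≤a (suc k′) (1≤leastB≥ 1≤j) (subst (b (suc k′) <_) 1+n≡aB (s≤s (least (suc k′) (s≤s z≤n) ≤-refl)))))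

module UlistAboveN {j n k} (1≤j : 1 ≤ j) (isN : IsN j n) (leastK : IsLeastK n k) where

  open SortedFilter (λ x → any? (λ y → x ≟ y) (Ulist j)) public

  private
    B = leastB≥ j
    1≤k = proj₁ leastK
    n<bk = proj₁ (proj₂ leastK)
    1+n≡aB : suc n ≡ a B
    1+n≡aB = IsN⇒suc≡a∘leastB≥ 1≤j isN
    aB≤bk : a B ≤ b k
    aB≤bk = subst (_≤ b k) 1+n≡aB n<bk

  b∈Ulist : ∀ i → suc (suc n) + i ≤ j → b (k + i) ∈ Ulist j
  b∈Ulist i bound = InU⇒∈Ulist (b∈U 1≤k+i (+leastB≥≤⇒a< (k + i) 1≤j 1≤k+i (begin
    k + i + B           ≡⟨ regroup k i B ⟩
    k + B + i           ≡⟨ cong (_+ i) (leastK+leastB≥ 1≤j isN leastK) ⟩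
    suc (suc n) + i     ≤⟨ bound ⟩
    j                   ∎)))
    where
    open ≤-Reasoning
    regroup : ∀ k i B → k + i + B ≡ k + B + i
    regroup = solve-∀
    1≤k+i : 1 ≤ k + i
    1≤k+i = ≤-trans 1≤k (m≤m+n k i)

  none-before-bk : ∀ y → a B ≤ y → y < b k → ¬ y ∈ Ulist j
  none-before-bk y aB≤y y<bk y∈ = [ above , (λ aB≡y → a∘leastB≥∉U 1≤j (subst (InU j) (sym aB≡y) y∈U)) ]′
                                      (m≤n⇒m<n∨m≡n aB≤y)
    where
    y∈U : InU j y
    y∈U = ∈Ulist⇒InU y∈
    above : ¬ (a B < y)
    above aB<y with ∈U-above-a∘leastB≥ 1≤j y∈U aB<y
    ... | m , 1≤m , bm≡y , _ with m <? k
    ...   | yes m<k = <-asym aB<y (subst₂ _<_ bm≡y 1+n≡aB (s≤s (proj₂ (proj₂ leastK) m 1≤m m<k)))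
    ...   | no m≮k = <⇒≱ y<bk (subst (b k ≤_) bm≡y (b-mono (≮⇒≥ m≮k)))

  none-between : ∀ i y → b (k + i) < y → y < b (k + suc i) → ¬ y ∈ Ulist j
  none-between i y lo hi y∈ =
    let m , _ , bm≡y , _ = ∈U-above-a∘leastB≥ 1≤j (∈Ulist⇒InU y∈) (≤-<-trans (≤-trans aB≤bk (b-mono (m≤m+n k i))) lo) in
    <⇒≱ (subst (m <_) (+-suc k i) (b-cancel-< {m} {k + suc i} (subst (_< b (k + suc i)) (sym bm≡y) hi)))
        (b-cancel-< {k + i} {m} (subst (b (k + i) <_) (sym bm≡y) lo))

  rank∘b : ∀ i → suc (suc n) + i ≤ j → rank (b (k + i)) ≡ suc n + i
  rank∘b zero _ = begin
    rank (b (k + 0))    ≡⟨ cong (λ x → rank (b x)) (+-identityʳ k) ⟩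
    rank (b k)          ≡⟨ rank-gap aB≤bk none-before-bk ⟩
    rank (a B)          ≡⟨ rank-all (a B) (λ y y<aB → InU⇒∈Ulist (<a∘leastB≥⇒∈U 1≤j y<aB)) ⟩
    a B                 ≡⟨ sym 1+n≡aB ⟩
    suc n               ≡⟨ sym (+-identityʳ (suc n)) ⟩
    suc n + 0           ∎
    where open ≡-Reasoning
  rank∘b (suc i) bound = begin
    rank (b (k + suc i))        ≡⟨ rank-gap (b-strict (subst (k + i <_) (sym (+-suc k i)) ≤-refl)) (none-between i) ⟩
    rank (suc (b (k + i)))      ≡⟨ rank-accept (b∈Ulist i bound′) ⟩
    suc (rank (b (k + i)))      ≡⟨ cong suc (rank∘b i bound′) ⟩
    suc (suc n + i)             ≡⟨ sym (+-suc (suc n) i) ⟩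
    suc n + suc i               ∎
    where
    open ≡-Reasoning
    bound′ : suc (suc n) + i ≤ j
    bound′ = ≤-trans (+-monoʳ-≤ (suc (suc n)) (n≤1+n i)) bound

nth-Uasc : ∀ {j n k} → 1 ≤ j → IsN j n → IsLeastK n k →
           ∀ i → suc (suc n) + i ≤ j → nth (suc n + i) (Uasc j) ≡ just (b (k + i))
nth-Uasc {j} 1≤j isN leastK i bound =
  trans (cong (λ r → nth r (Uasc j)) (sym (rank∘b i bound)))
        (nth-rank (suc (foldr _⊔_ 0 (Ulist j))) (s≤s (∈⇒≤foldr-⊔ (Ulist j) (b∈Ulist i bound))) (b∈Ulist i bound))
  where open UlistAboveN 1≤j isN leastK

lemma5p5 : ∀ (j : ℕ) →
    (1 ≤ j → ∀ (z : ℤ) → InW j z ⇔ ((+ mfun j) ℤ.≤ z × z ℤ.≤ (+ a j)))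
    × (1 ≤ j → ∀ n → IsN j n → ∀ k → IsLeastK n k →
         ∀ i → 1 ≤ i → i + n + 1 ≤ j → nth (n + i) (Uasc j) ≡ just (b (k + i ∸ 1)))
    × (1 ≤ j → InT₁ j → ∀ n → IsN j n → n + 2 ≡ mfun j)
    × (1 ≤ j → InT₂ j → ∀ n → IsN j n → n + 1 ≡ mfun j)
    × (1 ≤ j → InT₃ j → ∀ n → IsN j n → n ≡ mfun j)
    × ((j ≡ 0 → ∀ (z : ℤ) → ¬ (z ∈ S j))
       × (InA j → ∀ (z : ℤ) → (z ∈ S j) ⇔ ((+ 0) ℤ.≤ z × z ℤ.≤ (+ a j)))
       × (InB j → ∀ (z : ℤ) → (z ∈ S j) ⇔ ((+ 0) ℤ.≤ z × z ℤ.≤ (+ a j) × z ≢ (+ floorφ-1 j))))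
    × ((j ≡ 0 → q j ≡ 0)
       × (InA j → q j ≡ a j + 1)
       × (InB j → q j ≡ floorφ-1 j))
lemma5p5 j =
    W≡range
  , nth-U
  , (λ _ → n-on-T₁) , (λ _ → n-on-T₂) , (λ _ → n-on-T₃)
  , ((λ { refl _ () }) , S-on-A , S-on-B)
  , ((λ { refl → refl }) , q-on-A , q-on-B)
  where
  nth-U : 1 ≤ j → ∀ n → IsN j n → ∀ k → IsLeastK n k →
          ∀ i → 1 ≤ i → i + n + 1 ≤ j → nth (n + i) (Uasc j) ≡ just (b (k + i ∸ 1))
  nth-U 1≤j n isN k leastK (suc i) _ bound = begin
    nth (n + suc i) (Uasc j)    ≡⟨ cong (λ r → nth r (Uasc j)) (+-suc n i) ⟩
    nth (suc n + i) (Uasc j)    ≡⟨ nth-Uasc 1≤j isN leastK i (subst (_≤ j) (regroup i n) bound) ⟩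
    just (b (k + i))            ≡⟨ cong (λ x → just (b (x ∸ 1))) (sym (+-suc k i)) ⟩
    just (b (k + suc i ∸ 1))    ∎
    where
    open ≡-Reasoning
    regroup : ∀ i n → suc i + n + 1 ≡ suc (suc n) + i
    regroup = solve-∀
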